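{- There is an absolute constant $C>0$ such that the following holds. Let $n=2^m$ for some $m\in\mathbb{N}$. Then in every proper edge coloring of $K_n$ and for every integer $k\ge 1$, there is a $k$-rainbow path of length (number of edges) at least $(1-1/2^k)n - Ck$.
   Context: A proper edge coloring of a graph $G=(V,E)$ is a map $c\colon E\to\mathbb{N}$ such that any two distinct edges sharing an endpoint receive different colors. A $k$-rainbow path is a path in which no color appears on more than $k$ of its edges. The paper states the bound as $(1-1/2^k)n - O(k)$; here the $O(k)$ term is made explicit as $Ck$ with $C$ independent of $m$, $k$ and the coloring. -}

module Defs where

open import Data.Nat using (ℕ; zero; suc; _+_; _*_; _≤_)
open import Data.Fin using (Fin)
open import Data.List using (List; []; _∷_; length; filter)
open import Data.Nat using (_≟_)
open import Data.List.Relation.Unary.Unique.Propositional using (Unique)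
open import Relation.Binary.PropositionalEquality using (_≡_; _≢_)
open import Data.Product using (_×_)
open import Data.Empty using (⊥)

-- An edge colouring of the complete graph K_n on vertex set Fin n:
-- the colour of edge {u,v} (u ≢ v) is c u v; values on the diagonal are irrelevant.
Colouring : ℕ → Set
Colouring n = Fin n → Fin n → ℕ

IsProperColouring : {n : ℕ} → Colouring n → Set
IsProperColouring {n} c =
  ((u v : Fin n) → u ≢ v → c u v ≡ c v u)  ×
  ((u v w : Fin n) → u ≢ v → u ≢ w → v ≢ w → c u v ≢ c u w)

edgeColours : {n : ℕ} → Colouring n → List (Fin n) → List ℕ
edgeColours c [] = []
edgeColours c (x ∷ []) = []
edgeColours c (x ∷ y ∷ xs) = c x y ∷ edgeColours c (y ∷ xs)

count : ℕ → List ℕ → ℕ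
count a xs = length (filter (a ≟_) xs)

-- A path in K_n: a non-empty sequence of pairwise distinct vertices.
-- Its length (number of edges) is the number of vertices minus one.
IsPath : {n : ℕ} → List (Fin n) → Set
IsPath [] = ⊥
IsPath (x ∷ xs) = Unique (x ∷ xs)

IsKRainbow : {n : ℕ} → Colouring n → ℕ → List (Fin n) → Set
IsKRainbow c k P = (a : ℕ) → count a (edgeColours c P) ≤ k

-- Grow a path greedily at one end, adding only edges whose colour has not been used
-- in the current round, until no outside vertex can be attached.  Properness makes the
-- colours from the end vertex to the remaining outside vertices pairwise distinct and
-- all already used in this round, so if P has L vertices and the round adds s edges,
-- then n ≤ (L + s) + s: the number of missing vertices at least halves.  Each round
-- uses every colour at most once more, so k rounds give a k-rainbow path missing at
-- most n / 2^k vertices (this works for every n, not only powers of two).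
module Submission where

open import Defs
open import Data.Nat using (ℕ; zero; suc; _+_; _*_; _∸_; _^_; _≤_; z≤n; s≤s; _≟_)
open import Data.Nat.Properties
open import Data.Nat.Tactic.RingSolver using (solve-∀)
import Data.Fin.Properties as Fin
open import Data.Fin using (Fin; fromℕ<)
open import Data.List using (List; []; _∷_; [_]; length; _++_; map; filter; allFin)
open import Data.List.Properties using (length-++; length-map; length-tabulate; filter-++; filter-none; filter-accept; filter-reject)
open import Data.List.Relation.Unary.All as All using (All; []; _∷_)
open import Data.List.Relation.Unary.All.Properties using (¬Any⇒All¬; All¬⇒¬Any) renaming (map⁺ to All-map⁺)
open import Data.List.Relation.Unary.Any using (here; there; any?; satisfied)
open import Data.List.Relation.Unary.Unique.Propositional using (Unique; []; _∷_)
open import Data.List.Relation.Unary.Unique.Propositional.Properties using (allFin⁺; filter⁺)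
open import Data.List.Relation.Binary.Subset.Propositional using (_⊆_)
open import Data.List.Membership.Propositional using (_∈_; _∉_; lose)
open import Data.List.Membership.Propositional.Properties
  using (∈-∃++; ∈-++⁻; ∈-++⁺ˡ; ∈-++⁺ʳ; ∈-allFin; ∈-map⁻; ∈-filter⁺; ∈-filter⁻)
import Data.List.Membership.DecPropositional as DecMembership
open import Data.Product using (Σ; _×_; ∃-syntax; _,_; proj₁; proj₂)
open import Data.Sum using (inj₁; inj₂)
open import Data.Empty using (⊥-elim)
open import Relation.Binary.PropositionalEquality using (_≡_; _≢_; refl; sym; trans; cong; ≢-sym; module ≡-Reasoning)
open import Relation.Nullary using (yes; no)
open import Relation.Nullary.Decidable using (_×-dec_; decidable-stable)

module _ {A : Set} where

  Unique∧⊆⇒length≤ : ∀ {xs ys : List A} → Unique xs → xs ⊆ ys → length xs ≤ length ys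
  Unique∧⊆⇒length≤ {[]} _ _ = z≤n
  Unique∧⊆⇒length≤ {x ∷ xs} {ys} (x∉xs ∷ xs!) xs⊆ys with ∈-∃++ (xs⊆ys (here refl))
  ... | as , bs , refl = begin
    suc (length xs)              ≤⟨ s≤s (Unique∧⊆⇒length≤ xs! xs⊆as++bs) ⟩
    suc (length (as ++ bs))      ≡⟨ cong suc (length-++ as) ⟩
    suc (length as + length bs)  ≡⟨ sym (+-suc (length as) (length bs)) ⟩
    length as + length (x ∷ bs)  ≡⟨ sym (length-++ as) ⟩
    length (as ++ x ∷ bs)        ∎
    where
    open ≤-Reasoning
    xs⊆as++bs : xs ⊆ as ++ bs
    xs⊆as++bs z∈xs with ∈-++⁻ as (xs⊆ys (there z∈xs))
    ... | inj₁ z∈as = ∈-++⁺ˡ z∈as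
    ... | inj₂ (here refl) = ⊥-elim (All.lookup x∉xs z∈xs refl)
    ... | inj₂ (there z∈bs) = ∈-++⁺ʳ as z∈bs

module _ {A B : Set} (f : A → B) where

  map⁺-injectiveOn : ∀ {xs} → (∀ {u v} → u ∈ xs → v ∈ xs → f u ≡ f v → u ≡ v) →
                     Unique xs → Unique (map f xs)
  map⁺-injectiveOn {[]} _ [] = []
  map⁺-injectiveOn {x ∷ xs} inj (x∉xs ∷ xs!) =
    All-map⁺ (All.tabulate λ v∈xs fx≡fv → All.lookup x∉xs v∈xs (inj (here refl) (there v∈xs) fx≡fv))
    ∷ map⁺-injectiveOn (λ u∈xs v∈xs → inj (there u∈xs) (there v∈xs)) xs!

count-++ : ∀ a xs ys → count a (xs ++ ys) ≡ count a xs + count a ys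
count-++ a xs ys = trans (cong length (filter-++ (a ≟_) xs ys)) (length-++ (filter (a ≟_) xs))

count-∉ : ∀ {a xs} → a ∉ xs → count a xs ≡ 0
count-∉ {a} a∉xs = cong length (filter-none (a ≟_) (¬Any⇒All¬ _ a∉xs))

Unique⇒count≤1 : ∀ a {xs} → Unique xs → count a xs ≤ 1
Unique⇒count≤1 a {[]} [] = z≤n
Unique⇒count≤1 a {b ∷ xs} (b∉xs ∷ xs!) with a ≟ b
... | yes refl rewrite filter-accept (a ≟_) {a} {xs} refl = s≤s (≤-reflexive (count-∉ (All¬⇒¬Any b∉xs)))
... | no a≢b rewrite filter-reject (a ≟_) {b} {xs} a≢b = Unique⇒count≤1 a xs!

doubling : ∀ t n L L′ → t * n ≤ n + t * L → n + L ≤ L′ + L′ → 2 * t * n ≤ n + 2 * t * L′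
doubling t n L L′ bound halving = begin
  2 * t * n              ≡⟨ twice t n ⟩
  t * n + t * n          ≤⟨ +-monoʳ-≤ (t * n) bound ⟩
  t * n + (n + t * L)    ≡⟨ regroup t n L ⟩
  n + t * (n + L)        ≤⟨ +-monoʳ-≤ n (*-monoʳ-≤ t halving) ⟩
  n + t * (L′ + L′)      ≡⟨ cong (n +_) (sym (twice′ t L′)) ⟩
  n + 2 * t * L′         ∎
  where
  open ≤-Reasoning
  twice : ∀ t n → 2 * t * n ≡ t * n + t * n
  twice = solve-∀
  twice′ : ∀ t L → 2 * t * L ≡ t * (L + L)
  twice′ = solve-∀
  regroup : ∀ t n L → t * n + (n + t * L) ≡ n + t * (n + L)
  regroup = solve-∀

missing≤ : ∀ {t n L C k} → 1 ≤ C → 1 ≤ k → t * n ≤ n + t * suc L → (t ∸ 1) * n ≤ t * L + C * k * t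
missing≤ {t} {n} {L} {C} {k} 1≤C 1≤k bound = begin
  (t ∸ 1) * n      ≡⟨ *-distribʳ-∸ n t 1 ⟩
  t * n ∸ 1 * n    ≡⟨ cong (t * n ∸_) (*-identityˡ n) ⟩
  t * n ∸ n        ≤⟨ m≤n+o⇒m∸n≤o (t * n) n bound ⟩
  t * suc L        ≡⟨ trans (*-suc t L) (+-comm t (t * L)) ⟩
  t * L + t        ≡⟨ cong (t * L +_) (sym (*-identityˡ t)) ⟩
  t * L + 1 * t    ≤⟨ +-monoʳ-≤ (t * L) (*-monoˡ-≤ t (*-mono-≤ 1≤C 1≤k)) ⟩
  t * L + C * k * t ∎
  where open ≤-Reasoning

module Greedy {n : ℕ} (c : Colouring n) (proper : IsProperColouring c) where

  open DecMembership (Fin._≟_ {n}) using (_∈?_; _∉?_)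
  open DecMembership _≟_ using () renaming (_∈?_ to _∈ℕ?_; _∉?_ to _∉ℕ?_)

  colour-injective : ∀ {x u v} → u ≢ x → v ≢ x → c u x ≡ c v x → u ≡ v
  colour-injective {x} {u} {v} u≢x v≢x cux≡cvx with u Fin.≟ v
  ... | yes u≡v = u≡v
  ... | no u≢v = ⊥-elim (proj₂ proper x u v (≢-sym u≢x) (≢-sym v≢x) u≢v (begin
    c x u  ≡⟨ proj₁ proper x u (≢-sym u≢x) ⟩
    c u x  ≡⟨ cux≡cvx ⟩
    c v x  ≡⟨ proj₁ proper v x v≢x ⟩
    c x v  ∎))
    where open ≡-Reasoning

  saturated⇒length≤ : ∀ {x} Q S → x ∈ Q → (∀ {u} → u ∉ Q → c u x ∈ S) → n ≤ length Q + length S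
  saturated⇒length≤ {x} Q S x∈Q saturated = begin
    n                          ≡⟨ sym (length-tabulate (λ i → i)) ⟩
    length (allFin n)          ≤⟨ Unique∧⊆⇒length≤ (allFin⁺ n) allFin⊆Q++outside ⟩
    length (Q ++ outside)      ≡⟨ length-++ Q ⟩
    length Q + length outside  ≤⟨ +-monoʳ-≤ (length Q) outside≤S ⟩
    length Q + length S        ∎
    where
    open ≤-Reasoning
    outside : List (Fin n)
    outside = filter (_∉? Q) (allFin n)

    allFin⊆Q++outside : allFin n ⊆ Q ++ outside
    allFin⊆Q++outside {u} _ with u ∈? Q
    ... | yes u∈Q = ∈-++⁺ˡ u∈Q
    ... | no u∉Q = ∈-++⁺ʳ Q (∈-filter⁺ (_∉? Q) (∈-allFin u) u∉Q)

    outside⇒∉Q : ∀ {u} → u ∈ outside → u ∉ Q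
    outside⇒∉Q u∈outside = proj₂ (∈-filter⁻ (_∉? Q) {xs = allFin n} u∈outside)

    outside⇒≢x : ∀ {u} → u ∈ outside → u ≢ x
    outside⇒≢x u∈outside refl = outside⇒∉Q u∈outside x∈Q

    colourTo-x : Fin n → ℕ
    colourTo-x u = c u x

    colours⊆S : map colourTo-x outside ⊆ S
    colours⊆S a∈colours with ∈-map⁻ colourTo-x a∈colours
    ... | u , u∈outside , refl = saturated (outside⇒∉Q u∈outside)

    outside≤S : length outside ≤ length S
    outside≤S = begin
      length outside                   ≡⟨ sym (length-map colourTo-x outside) ⟩
      length (map colourTo-x outside)  ≤⟨ Unique∧⊆⇒length≤ colours-unique colours⊆S ⟩
      length S                         ∎
      where
      colours-unique : Unique (map colourTo-x outside)
      colours-unique = map⁺-injectiveOn colourTo-x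
        (λ u∈ v∈ → colour-injective (outside⇒≢x u∈) (outside⇒≢x v∈))
        (filter⁺ (_∉? Q) (allFin⁺ n))

  record Extension (P : List (Fin n)) : Set where
    constructor extension
    field
      end : Fin n
      rest : List (Fin n)
      fresh : List ℕ
      isPath : Unique (end ∷ rest)
      colours-≡ : edgeColours c (end ∷ rest) ≡ fresh ++ edgeColours c P
      fresh-unique : Unique fresh
      length-≡ : length fresh + length P ≡ suc (length rest)

    path : List (Fin n)
    path = end ∷ rest

  open Extension

  trivialExtension : ∀ P → IsPath P → Extension P
  trivialExtension (x ∷ xs) x∷xs! = extension x xs [] x∷xs! refl [] refl

  prepend : ∀ {P u} (e : Extension P) → u ∉ path e → c u (end e) ∉ fresh e → Extension P
  prepend {u = u} e u∉path cu∉fresh = extension u (path e) (c u (end e) ∷ fresh e)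
    (¬Any⇒All¬ _ u∉path ∷ isPath e)
    (cong (c u (end e) ∷_) (colours-≡ e))
    (¬Any⇒All¬ _ cu∉fresh ∷ fresh-unique e)
    (cong suc (length-≡ e))

  Halving : List (Fin n) → Set
  Halving P = ∃[ Q ] (IsPath Q
    × (∀ a → count a (edgeColours c Q) ≤ suc (count a (edgeColours c P)))
    × n + length P ≤ length Q + length Q)

  toHalving : ∀ {P} (e : Extension P) → n ≤ length (path e) + length (fresh e) → Halving P
  toHalving {P} e n≤ = path e , isPath e , count≤ , length≥
    where
    open ≤-Reasoning
    count≤ : ∀ a → count a (edgeColours c (path e)) ≤ suc (count a (edgeColours c P))
    count≤ a = begin
      count a (edgeColours c (path e))                   ≡⟨ cong (count a) (colours-≡ e) ⟩
      count a (fresh e ++ edgeColours c P)               ≡⟨ count-++ a (fresh e) _ ⟩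
      count a (fresh e) + count a (edgeColours c P)      ≤⟨ +-monoˡ-≤ _ (Unique⇒count≤1 a (fresh-unique e)) ⟩
      suc (count a (edgeColours c P))                    ∎
    length≥ : n + length P ≤ length (path e) + length (path e)
    length≥ = begin
      n + length P                                       ≤⟨ +-monoˡ-≤ (length P) n≤ ⟩
      length (path e) + length (fresh e) + length P      ≡⟨ +-assoc (length (path e)) _ _ ⟩
      length (path e) + (length (fresh e) + length P)    ≡⟨ cong (length (path e) +_) (length-≡ e) ⟩
      length (path e) + length (path e)                  ∎

  -- The fuel only ensures termination: when it runs out the path already has n vertices.
  extend : ∀ {P} (fuel : ℕ) (e : Extension P) → n ≤ fuel + length (path e) → Halving P
  extend zero e n≤ = toHalving e (≤-trans n≤ (m≤m+n _ _))
  extend (suc fuel) e n≤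
    with any? (λ u → u ∉? path e ×-dec c u (end e) ∉ℕ? fresh e) (allFin n)
  ... | yes found = let (u , u∉path , cu∉fresh) = satisfied found in
    extend fuel (prepend e u∉path cu∉fresh) (≤-trans n≤ (≤-reflexive (sym (+-suc fuel _))))
  ... | no none = toHalving e (saturated⇒length≤ (path e) (fresh e) (here refl) saturated)
    where
    saturated : ∀ {u} → u ∉ path e → c u (end e) ∈ fresh e
    saturated {u} u∉path = decidable-stable (c u (end e) ∈ℕ? fresh e)
      (λ cu∉fresh → none (lose (∈-allFin u) (u∉path , cu∉fresh)))

  halve : ∀ P → IsPath P → Halving P
  halve P@(_ ∷ _) isPath = extend n (trivialExtension P isPath) (m≤m+n n (length P))

  rainbowPath : Fin n → (k : ℕ) → ∃[ Q ] (IsPath Q × IsKRainbow c k Q × 2 ^ k * n ≤ n + 2 ^ k * length Q)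
  rainbowPath v zero = [ v ] , [] ∷ [] , (λ _ → z≤n) , +-monoʳ-≤ n z≤n
  rainbowPath v (suc k) with rainbowPath v k
  ... | P , isPath , rainbow , bound with halve P isPath
  ... | Q , isPathQ , count≤ , halving =
    Q , isPathQ , (λ a → ≤-trans (count≤ a) (s≤s (rainbow a))) ,
    doubling (2 ^ k) n (length P) (length Q) bound halving

proposition12 : Σ ℕ λ C → (1 ≤ C) ×
    ((m : ℕ) (c : Colouring (2 ^ m)) → IsProperColouring c →
     (k : ℕ) → 1 ≤ k →
     ∃[ P ] (IsPath P × IsKRainbow c k P ×
       ((2 ^ k ∸ 1) * 2 ^ m ≤ 2 ^ k * (length P ∸ 1) + C * k * 2 ^ k)))
proposition12 = 1 , ≤-refl , longRainbowPath
  where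
  longRainbowPath : (m : ℕ) (c : Colouring (2 ^ m)) → IsProperColouring c →
    (k : ℕ) → 1 ≤ k →
    ∃[ P ] (IsPath P × IsKRainbow c k P ×
      ((2 ^ k ∸ 1) * 2 ^ m ≤ 2 ^ k * (length P ∸ 1) + 1 * k * 2 ^ k))
  longRainbowPath m c proper k 1≤k with Greedy.rainbowPath c proper (fromℕ< (m^n>0 2 m)) k
  ... | P@(_ ∷ _) , isPath , rainbow , bound = P , isPath , rainbow , missing≤ ≤-refl 1≤k bound
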